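{- Let $\mathbf v$ be a complementary symmetric Rote sequence, $\mathbf u=\mathcal S(\mathbf v)$ the associated Sturmian sequence, and $\ell\in\mathbb N$. If $w$ is a bispecial factor of length $\ell$ in $\mathbf u$, then there are two bispecial factors $x,\bar x$ of length $\ell+1$ in $\mathbf v$ such that $w=\mathcal S(x)=\mathcal S(\bar x)$. Conversely, if $x$ is a bispecial factor of length $\ell+1$ in $\mathbf v$, then $\mathcal S(x)$ (of length $\ell$) is a bispecial factor of $\mathbf u$. Moreover, each non-empty bispecial factor of $\mathbf v$ is ordinary and the empty word is a strong bispecial factor of $\mathbf v$.
   Context: A Sturmian sequence is a sequence over $\{0,1\}$ with factor complexity $\mathcal C(n)=n+1$ for all $n$. A complementary symmetric Rote sequence is a sequence $\mathbf v\in\{0,1\}^{\mathbb N}$ with factor complexity $\mathcal C(n)=2n$ for all $n\ge1$ whose language is closed under the exchange $0\leftrightarrow1$. For $v=v_0\cdots v_n\in\{0,1\}^+$, $\mathcal S(v)=u_0\cdots u_{n-1}$ with $u_i=v_i+v_{i+1}\bmod 2$; for sequences, $\mathcal S(\mathbf v)_i=v_i+v_{i+1}\bmod2$. $\bar x$ is $x$ with letters exchanged. A factor $w$ of a sequence over alphabet $\mathcal A$ is right (resp. left) special if $wa,wb$ (resp. $aw,bw$) are factors for two distinct letters $a,b$; it is bispecial if both left and right special. The bilateral order of a bispecial factor $w$ is $B(w)=\#\{(a,b): awb\in\mathcal L\}-\#\{a: aw\in\mathcal L\}-\#\{b: wb\in\mathcal L\}+1$, where $\mathcal L$ is the set of factors;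 $w$ is ordinary if $B(w)=0$ and strong if $B(w)>0$. -}

module Defs where

open import Data.Bool using (Bool; true; false; not; _xor_)
open import Data.Nat using (ℕ; zero; suc; _≥_)
open import Data.Integer using (ℤ; +_; _-_; _+_; _>_)
open import Data.List using (List; []; _∷_; length; map; _++_; [_])
open import Data.List.Membership.Propositional using (_∈_)
open import Data.List.Relation.Unary.All using (All)
open import Data.List.Relation.Unary.Unique.Propositional using (Unique)
open import Data.Product using (Σ; ∃; _×_; _,_)
open import Relation.Binary.PropositionalEquality using (_≡_)

-- Binary sequences and words (0 = false, 1 = true)
Seq : Set
Seq = ℕ → Bool

Word : Set
Word = List Bool

HasCard : {A : Set} → (A → Set) → ℕ → Set
HasCard {A} P k = Σ (List A) λ xs →
  (length xs ≡ k) × Unique xs × All P xs × (∀ a → P a → a ∈ xs)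

segment : Seq → ℕ → ℕ → Word
segment s i zero    = []
segment s i (suc n) = s i ∷ segment s (suc i) n

Factor : Seq → Word → Set
Factor s w = ∃ λ i → segment s i (length w) ≡ w

Complexity : Seq → ℕ → ℕ → Set
Complexity s n k = HasCard (λ w → (length w ≡ n) × Factor s w) k

Sturmian : Seq → Set
Sturmian s = ∀ n → Complexity s n (suc n)

bar : Word → Word
bar = map not

CSRote : Seq → Set
CSRote v = (∀ n → n ≥ 1 → Complexity v n (n Data.Nat.+ n))
         × (∀ w → Factor v w → Factor v (bar w))

Sw : Word → Word
Sw (a ∷ b ∷ r) = (a xor b) ∷ Sw (b ∷ r)
Sw _           = []

Sseq : Seq → Seq
Sseq v i = v i xor v (suc i)

LeftSpecial : Seq → Word → Set
LeftSpecial s w = ∃ λ a → ∃ λ b → (a ≡ b → Data.Empty.⊥) × Factor s (a ∷ w) × Factor s (b ∷ w)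
  where import Data.Empty

RightSpecial : Seq → Word → Set
RightSpecial s w = ∃ λ a → ∃ λ b → (a ≡ b → Data.Empty.⊥) × Factor s (w ++ [ a ]) × Factor s (w ++ [ b ])
  where import Data.Empty

Bispecial : Seq → Word → Set
Bispecial s w = LeftSpecial s w × RightSpecial s w

BilateralOrder : Seq → Word → ℤ → Set
BilateralOrder s w z = ∃ λ k₁ → ∃ λ k₂ → ∃ λ k₃ →
    HasCard {Bool × Bool} (λ { (a , b) → Factor s (a ∷ w ++ [ b ]) }) k₁
  × HasCard {Bool} (λ a → Factor s (a ∷ w)) k₂
  × HasCard {Bool} (λ b → Factor s (w ++ [ b ])) k₃
  × (z ≡ (+ k₁ - + k₂ - + k₃) + + 1)

Ordinary : Seq → Word → Set
Ordinary s w = BilateralOrder s w (+ 0)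

Strong : Seq → Word → Set
Strong s w = ∃ λ z → BilateralOrder s w z × (z > + 0)

-- Since Sw (bar x) = Sw x and Sw is otherwise injective on words of equal length, closure
-- of the language of v under bar makes the Sw-preimages of a factor of Sseq v factors of v.
-- Extensions then move back and forth under Sw by xor with the first and the last letter,
-- which settles the correspondence of bispecial factors. For the bilateral orders we count:
-- C(n + 1) - C(n) = 2 means that v has exactly two right special factors of each positive
-- length, so those of length |x| are x and bar x when x is bispecial. Then exactly one of
-- 0x, 1x is right special: both would give three right special factors 0x, 1x, bar (1x),
-- neither would leave none of length |x| + 1. Hence x has three bilateral extensions and
-- B(x) = 3 - 2 - 2 + 1 = 0, while C(1) = 2 and C(2) = 4 force all words of length at
-- most 2 to occur, so B([]) = 4 - 2 - 2 + 1 = 1.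

module Submission where

open import Defs
open import Data.Bool using (Bool; true; false; not; _xor_)
open import Data.Bool.Properties
  using ( not-involutive; not-injective; not-¬; ¬-not
        ; xor-annihilates-not; xor-assoc; xor-comm; xor-same; xor-identityʳ )
  renaming (_≟_ to _≟ᵇ_)
open import Data.Empty using (⊥; ⊥-elim)
open import Data.Integer using (+_; +<+)
open import Data.List using (List; []; _∷_; length; map; _++_; [_]; _∷ʳ_; cartesianProduct; initLast; _∷ʳ′_)
open import Data.List.Properties
  using (≡-dec; ∷-injective; ∷ʳ-injective; ∷ʳ-injectiveˡ; length-map; length-++; length-removeAt′; map-++)
open import Data.List.Membership.Propositional using (_∈_; _─_)
open import Data.List.Membership.Propositional.Properties using (∈-map⁺; ∈-map⁻; ∈-++⁻; ∈-cartesianProduct⁺)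
open import Data.List.Relation.Binary.Subset.Propositional using (_⊆_)
open import Data.List.Relation.Unary.All using (All; []; _∷_; tabulate) renaming (lookup to All-lookup)
open import Data.List.Relation.Unary.All.Properties.Core using (¬Any⇒All¬)
open import Data.List.Relation.Unary.AllPairs using ([]; _∷_)
open import Data.List.Relation.Unary.Any using (here; there; index; any?)
open import Data.List.Relation.Unary.Unique.Propositional using (Unique)
open import Data.List.Relation.Unary.Unique.Propositional.Properties using (map⁺; ++⁺; cartesianProduct⁺)
open import Data.Nat using (ℕ; zero; suc; _+_; _≤_; _≥_; z≤n; s≤s)
open import Data.Nat.Properties
  using (+-comm; +-suc; +-identityʳ; ≤-trans; ≤-reflexive; 1+n≰n; n≤1+n; +-monoʳ-≤; suc-injective)
open import Data.Product using (Σ; ∃; _×_; _,_; proj₁; proj₂)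
open import Data.Sum using (_⊎_; inj₁; inj₂; [_,_]′)
open import Function using (_∘_)
open import Relation.Binary.Definitions using (DecidableEquality)
open import Relation.Binary.PropositionalEquality
  using (_≡_; _≢_; refl; sym; trans; cong; cong₂; subst; subst₂; module ≡-Reasoning)
open import Relation.Nullary using (¬_; Dec; yes; no; isNo)

module _ {A : Set} where

  ∈-─⁺ : ∀ {x y : A} {ys} (x∈ys : x ∈ ys) → y ∈ ys → y ≢ x → y ∈ ys ─ x∈ys
  ∈-─⁺ (here refl)  (here refl)  y≢x = ⊥-elim (y≢x refl)
  ∈-─⁺ (here refl)  (there y∈ys) _   = y∈ys
  ∈-─⁺ (there _)    (here refl)  _   = here refl
  ∈-─⁺ (there x∈ys) (there y∈ys) y≢x = there (∈-─⁺ x∈ys y∈ys y≢x)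

  Unique-⊆⇒length-≤ : ∀ {xs ys : List A} → Unique xs → xs ⊆ ys → length xs ≤ length ys
  Unique-⊆⇒length-≤ {[]}     _            _     = z≤n
  Unique-⊆⇒length-≤ {x ∷ xs} {ys} (x∉xs ∷ u) xs⊆ys =
    subst (suc (length xs) ≤_) (sym (length-removeAt′ ys (index x∈ys)))
      (s≤s (Unique-⊆⇒length-≤ u (λ y∈xs → ∈-─⁺ x∈ys (xs⊆ys (there y∈xs)) (All-lookup x∉xs y∈xs ∘ sym))))
    where
    x∈ys : x ∈ ys
    x∈ys = xs⊆ys (here refl)

  Unique-⊆-length-≥⇒⊇ : DecidableEquality A → ∀ {xs ys : List A} →
    Unique xs → xs ⊆ ys → length ys ≤ length xs → ys ⊆ xs
  Unique-⊆-length-≥⇒⊇ _≟_ {xs} {ys} u xs⊆ys ys≤xs {y} y∈ys with any? (y ≟_) xs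
  ... | yes y∈xs = y∈xs
  ... | no  y∉xs = ⊥-elim (1+n≰n (≤-trans (Unique-⊆⇒length-≤ (¬Any⇒All¬ xs y∉xs ∷ u) y∷xs⊆ys) ys≤xs))
    where
    y∷xs⊆ys : y ∷ xs ⊆ ys
    y∷xs⊆ys (here refl)  = y∈ys
    y∷xs⊆ys (there z∈xs) = xs⊆ys z∈xs

  HasCard-full : ∀ {P : A → Set} (xs : List A) → Unique xs → (∀ a → a ∈ xs) → (∀ a → P a) → HasCard P (length xs)
  HasCard-full xs u complete p = xs , refl , u , tabulate (λ {a} _ → p a) , λ a _ → complete a

booleans : List Bool
booleans = false ∷ true ∷ []

booleans-unique : Unique booleans
booleans-unique = ((λ ()) ∷ []) ∷ [] ∷ []

booleans-complete : ∀ b → b ∈ booleans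
booleans-complete false = here refl
booleans-complete true  = there (here refl)

∀Bool-from-≢ : ∀ {P : Bool → Set} {a b} → a ≢ b → P a → P b → ∀ c → P c
∀Bool-from-≢ {a = false} {false} a≢b _  _  _     = ⊥-elim (a≢b refl)
∀Bool-from-≢ {a = false} {true}  _   pa _  false = pa
∀Bool-from-≢ {a = false} {true}  _   _  pb true  = pb
∀Bool-from-≢ {a = true}  {false} _   _  pb false = pb
∀Bool-from-≢ {a = true}  {false} _   pa _  true  = pa
∀Bool-from-≢ {a = true}  {true}  a≢b _  _  _     = ⊥-elim (a≢b refl)

xor-cancelˡ : ∀ a {b c} → a xor b ≡ a xor c → b ≡ c
xor-cancelˡ false eq = eq
xor-cancelˡ true  eq = not-injective eq

xor-cancelʳ : ∀ a {b c} → b xor a ≡ c xor a → b ≡ c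
xor-cancelʳ a {b} {c} eq = xor-cancelˡ a (trans (xor-comm a b) (trans eq (xor-comm c a)))

xor-involutiveˡ : ∀ a b → a xor (a xor b) ≡ b
xor-involutiveˡ false b = refl
xor-involutiveˡ true  b = not-involutive b

xor-involutiveʳ : ∀ a b → (b xor a) xor a ≡ b
xor-involutiveʳ a b = trans (xor-assoc b a a) (trans (cong (b xor_) (xor-same a)) (xor-identityʳ b))

_≟ʷ_ : DecidableEquality Word
_≟ʷ_ = ≡-dec _≟ᵇ_

length-∷ʳ : ∀ (w : Word) b → length (w ∷ʳ b) ≡ suc (length w)
length-∷ʳ w b = trans (length-++ w) (+-comm (length w) 1)

length-segment : ∀ s i n → length (segment s i n) ≡ n
length-segment s i zero    = refl
length-segment s i (suc n) = cong suc (length-segment s (suc i) n)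

segment-suc : ∀ s i n → segment s i (suc n) ≡ segment s i n ∷ʳ s (i + n)
segment-suc s i zero    = cong (λ j → [ s j ]) (sym (+-identityʳ i))
segment-suc s i (suc n) = cong (s i ∷_)
  (trans (segment-suc s (suc i) n) (cong (λ j → segment s (suc i) n ∷ʳ s j) (sym (+-suc i n))))

Factor-∷⁻ : ∀ {s c w} → Factor s (c ∷ w) → Factor s w
Factor-∷⁻ (i , eq) = suc i , proj₂ (∷-injective eq)

Factor-∷ʳ⁻ : ∀ {s w b} → Factor s (w ∷ʳ b) → Factor s w
Factor-∷ʳ⁻ {s} {w} {b} (i , eq) = i , ∷ʳ-injectiveˡ (segment s i (length w)) w (begin
  segment s i (length w) ∷ʳ s (i + length w) ≡⟨ segment-suc s i (length w) ⟨
  segment s i (suc (length w))               ≡⟨ cong (segment s i) (length-∷ʳ w b) ⟨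
  segment s i (length (w ∷ʳ b))              ≡⟨ eq ⟩
  w ∷ʳ b                                     ∎)
  where open ≡-Reasoning

Factor-extendʳ : ∀ {s w} → Factor s w → ∃ λ b → Factor s (w ∷ʳ b)
Factor-extendʳ {s} {w} (i , eq) = s (i + length w) , i , (begin
  segment s i (length (w ∷ʳ s (i + length w))) ≡⟨ cong (segment s i) (length-∷ʳ w _) ⟩
  segment s i (suc (length w))                 ≡⟨ segment-suc s i (length w) ⟩
  segment s i (length w) ∷ʳ s (i + length w)   ≡⟨ cong (_∷ʳ s (i + length w)) eq ⟩
  w ∷ʳ s (i + length w)                        ∎)
  where open ≡-Reasoning

bar-∷ʳ : ∀ w b → bar (w ∷ʳ b) ≡ bar w ∷ʳ not b
bar-∷ʳ w b = map-++ not w [ b ]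

bar-involutive : ∀ w → bar (bar w) ≡ w
bar-involutive []      = refl
bar-involutive (b ∷ w) = cong₂ _∷_ (not-involutive b) (bar-involutive w)

length-bar : ∀ w → length (bar w) ≡ length w
length-bar = length-map not

∷-≢-bar : ∀ a w → a ∷ w ≢ bar (a ∷ w)
∷-≢-bar a w eq = not-¬ refl (proj₁ (∷-injective eq))

BarClosed : Seq → Set
BarClosed s = ∀ w → Factor s w → Factor s (bar w)

Bispecial-bar : ∀ {s} → BarClosed s → ∀ {x} → Bispecial s x → Bispecial s (bar x)
Bispecial-bar {s} closed {x} ((a , b , a≢b , fa , fb) , (c , d , c≢d , fc , fd)) =
  (not a , not b , a≢b ∘ not-injective , closed _ fa , closed _ fb) ,
  (not c , not d , c≢d ∘ not-injective , bar-extendʳ fc , bar-extendʳ fd)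
  where
  bar-extendʳ : ∀ {e} → Factor s (x ∷ʳ e) → Factor s (bar x ∷ʳ not e)
  bar-extendʳ {e} f = subst (Factor s) (bar-∷ʳ x e) (closed _ f)

last⁺ : Bool → Word → Bool
last⁺ a []      = a
last⁺ _ (b ∷ w) = last⁺ b w

length-Sw : ∀ a w → length (Sw (a ∷ w)) ≡ length w
length-Sw a []      = refl
length-Sw a (b ∷ w) = cong suc (length-Sw b w)

Sw-∷ʳ : ∀ a w b → Sw ((a ∷ w) ∷ʳ b) ≡ Sw (a ∷ w) ∷ʳ (last⁺ a w xor b)
Sw-∷ʳ a []      b = refl
Sw-∷ʳ a (c ∷ w) b = cong ((a xor c) ∷_) (Sw-∷ʳ c w b)

Sw-bar : ∀ w → Sw (bar w) ≡ Sw w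
Sw-bar []          = refl
Sw-bar (a ∷ [])    = refl
Sw-bar (a ∷ b ∷ w) = cong₂ _∷_ (xor-annihilates-not a b) (Sw-bar (b ∷ w))

Sw-∷-injective : ∀ a {w w′} → length w ≡ length w′ → Sw (a ∷ w) ≡ Sw (a ∷ w′) → w ≡ w′
Sw-∷-injective a {[]}    {[]}      _    _  = refl
Sw-∷-injective a {b ∷ w} {b′ ∷ w′} ∣w∣≡ eq with xor-cancelˡ a (proj₁ (∷-injective eq))
... | refl = cong (b ∷_) (Sw-∷-injective b (suc-injective ∣w∣≡) (proj₂ (∷-injective eq)))

Sw-injective-up-to-bar : ∀ {y x} → length y ≡ length x → Sw y ≡ Sw x → y ≡ x ⊎ y ≡ bar x
Sw-injective-up-to-bar {[]}    {[]}    _    _  = inj₁ refl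
Sw-injective-up-to-bar {a ∷ y} {b ∷ x} ∣y∣≡ eq with a ≟ᵇ b
... | yes refl = inj₁ (cong (a ∷_) (Sw-∷-injective a (suc-injective ∣y∣≡) eq))
... | no a≢b with ¬-not a≢b
...   | refl = inj₂ (cong (not b ∷_) (Sw-∷-injective (not b)
                 (trans (suc-injective ∣y∣≡) (sym (length-bar x))) (trans eq (sym (Sw-bar (b ∷ x))))))

segment-Sseq : ∀ v i n → segment (Sseq v) i n ≡ Sw (segment v i (suc n))
segment-Sseq v i zero    = refl
segment-Sseq v i (suc n) = cong (Sseq v i ∷_) (segment-Sseq v (suc i) n)

Factor-Sw : ∀ {v y} → Factor v y → Factor (Sseq v) (Sw y)
Factor-Sw {v} {[]}    _        = 0 , refl
Factor-Sw {v} {a ∷ w} (i , eq) = i , (begin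
  segment (Sseq v) i (length (Sw (a ∷ w))) ≡⟨ cong (segment (Sseq v) i) (length-Sw a w) ⟩
  segment (Sseq v) i (length w)            ≡⟨ segment-Sseq v i (length w) ⟩
  Sw (segment v i (length (a ∷ w)))        ≡⟨ cong Sw eq ⟩
  Sw (a ∷ w)                               ∎)
  where open ≡-Reasoning

Factor-Sseq⁻ : ∀ {v z} → Factor (Sseq v) z → ∃ λ y → Factor v y × Sw y ≡ z × length y ≡ suc (length z)
Factor-Sseq⁻ {v} {z} (i , eq) =
  segment v i (suc (length z)) ,
  (i , cong (segment v i) (length-segment v i (suc (length z)))) ,
  trans (sym (segment-Sseq v i (length z))) eq ,
  length-segment v i (suc (length z))

LeftSpecial-Sw⁺ : ∀ {v a w} → LeftSpecial v (a ∷ w) → LeftSpecial (Sseq v) (Sw (a ∷ w))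
LeftSpecial-Sw⁺ {v} {a} (c , d , c≢d , fc , fd) =
  c xor a , d xor a , c≢d ∘ xor-cancelʳ a , Factor-Sw {v} fc , Factor-Sw {v} fd

RightSpecial-Sw⁺ : ∀ {v a w} → RightSpecial v (a ∷ w) → RightSpecial (Sseq v) (Sw (a ∷ w))
RightSpecial-Sw⁺ {v} {a} {w} (c , d , c≢d , fc , fd) =
  last⁺ a w xor c , last⁺ a w xor d , c≢d ∘ xor-cancelˡ (last⁺ a w) , extend fc , extend fd
  where
  extend : ∀ {e} → Factor v ((a ∷ w) ∷ʳ e) → Factor (Sseq v) (Sw (a ∷ w) ∷ʳ (last⁺ a w xor e))
  extend {e} f = subst (Factor (Sseq v)) (Sw-∷ʳ a w e) (Factor-Sw {v} f)

Bispecial-Sw⁺ : ∀ {v a w} → Bispecial v (a ∷ w) → Bispecial (Sseq v) (Sw (a ∷ w))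
Bispecial-Sw⁺ (ls , rs) = LeftSpecial-Sw⁺ ls , RightSpecial-Sw⁺ rs

module _ {v : Seq} (closed : BarClosed v) where

  Factor-Sw⁻ : ∀ a w → Factor (Sseq v) (Sw (a ∷ w)) → Factor v (a ∷ w)
  Factor-Sw⁻ a w f with Factor-Sseq⁻ {v} f
  ... | y , fy , Sy≡ , ∣y∣≡ with Sw-injective-up-to-bar (trans ∣y∣≡ (cong suc (length-Sw a w))) Sy≡
  ...   | inj₁ refl = fy
  ...   | inj₂ refl = subst (Factor v) (bar-involutive (a ∷ w)) (closed _ fy)

  LeftSpecial-Sw⁻ : ∀ {a w} → LeftSpecial (Sseq v) (Sw (a ∷ w)) → LeftSpecial v (a ∷ w)
  LeftSpecial-Sw⁻ {a} {w} (c , d , c≢d , fc , fd) =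
    c xor a , d xor a , c≢d ∘ xor-cancelʳ a , lift fc , lift fd
    where
    lift : ∀ {e} → Factor (Sseq v) (e ∷ Sw (a ∷ w)) → Factor v ((e xor a) ∷ a ∷ w)
    lift {e} f = Factor-Sw⁻ (e xor a) (a ∷ w)
      (subst (λ e′ → Factor (Sseq v) (e′ ∷ Sw (a ∷ w))) (sym (xor-involutiveʳ a e)) f)

  RightSpecial-Sw⁻ : ∀ {a w} → RightSpecial (Sseq v) (Sw (a ∷ w)) → RightSpecial v (a ∷ w)
  RightSpecial-Sw⁻ {a} {w} (c , d , c≢d , fc , fd) =
    last⁺ a w xor c , last⁺ a w xor d , c≢d ∘ xor-cancelˡ (last⁺ a w) , lift fc , lift fd
    where
    lift : ∀ {e} → Factor (Sseq v) (Sw (a ∷ w) ∷ʳ e) → Factor v ((a ∷ w) ∷ʳ (last⁺ a w xor e))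
    lift {e} f = Factor-Sw⁻ a (w ∷ʳ (ℓ xor e)) (subst (Factor (Sseq v)) (sym (begin
      Sw ((a ∷ w) ∷ʳ (ℓ xor e))     ≡⟨ Sw-∷ʳ a w (ℓ xor e) ⟩
      Sw (a ∷ w) ∷ʳ (ℓ xor (ℓ xor e)) ≡⟨ cong (Sw (a ∷ w) ∷ʳ_) (xor-involutiveˡ ℓ e) ⟩
      Sw (a ∷ w) ∷ʳ e               ∎)) f)
      where
      open ≡-Reasoning
      ℓ = last⁺ a w

  Bispecial-Sw⁻ : ∀ {a w} → Bispecial (Sseq v) (Sw (a ∷ w)) → Bispecial v (a ∷ w)
  Bispecial-Sw⁻ (ls , rs) = LeftSpecial-Sw⁻ ls , RightSpecial-Sw⁻ rs

  Bispecial-Sseq⇒preimages : ∀ ℓ w → length w ≡ ℓ → Bispecial (Sseq v) w →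
    Σ Word λ x → (length x ≡ suc ℓ) × Bispecial v x × Bispecial v (bar x) × (w ≡ Sw x) × (w ≡ Sw (bar x))
  Bispecial-Sseq⇒preimages ℓ w ∣w∣≡ bs@((_ , _ , _ , fa , _) , _) with Factor-Sseq⁻ {v} (Factor-∷⁻ fa)
  ... | [] , _ , _ , ()
  ... | a ∷ u , _ , refl , ∣x∣≡ =
    a ∷ u , trans ∣x∣≡ (cong suc ∣w∣≡) , bsx , Bispecial-bar closed bsx , refl , sym (Sw-bar (a ∷ u))
    where
    bsx : Bispecial v (a ∷ u)
    bsx = Bispecial-Sw⁻ bs

LeftSpecial₂ : Seq → Word → Set
LeftSpecial₂ s w = ∀ a → Factor s (a ∷ w)

RightSpecial₂ : Seq → Word → Set
RightSpecial₂ s w = ∀ b → Factor s (w ∷ʳ b)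

LeftSpecial⇒LeftSpecial₂ : ∀ {s w} → LeftSpecial s w → LeftSpecial₂ s w
LeftSpecial⇒LeftSpecial₂ {s} {w} (_ , _ , a≢b , fa , fb) = ∀Bool-from-≢ {P = λ c → Factor s (c ∷ w)} a≢b fa fb

RightSpecial⇒RightSpecial₂ : ∀ {s} w → RightSpecial s w → RightSpecial₂ s w
RightSpecial⇒RightSpecial₂ {s} w (_ , _ , a≢b , fa , fb) = ∀Bool-from-≢ {P = λ c → Factor s (w ∷ʳ c)} a≢b fa fb

LeftSpecial₂⇒LeftSpecial : ∀ {s w} → LeftSpecial₂ s w → LeftSpecial s w
LeftSpecial₂⇒LeftSpecial f = false , true , (λ ()) , f false , f true

RightSpecial₂⇒RightSpecial : ∀ {s} w → RightSpecial₂ s w → RightSpecial s w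
RightSpecial₂⇒RightSpecial _ f = false , true , (λ ()) , f false , f true

RightSpecial₂-∷⁻ : ∀ {s c w} → RightSpecial₂ s (c ∷ w) → RightSpecial₂ s w
RightSpecial₂-∷⁻ r b = Factor-∷⁻ (r b)

RightSpecial₂-bar : ∀ {s} → BarClosed s → ∀ w → RightSpecial₂ s w → RightSpecial₂ s (bar w)
RightSpecial₂-bar {s} closed w r b =
  subst (Factor s) (trans (bar-∷ʳ w (not b)) (cong (bar w ∷ʳ_) (not-involutive b))) (closed _ (r (not b)))

HasCard-bilateralExtensions : ∀ {s x c} → Factor s (not c ∷ x) →
  RightSpecial₂ s (c ∷ x) → ¬ RightSpecial₂ s (not c ∷ x) →
  HasCard (λ ab → Factor s (proj₁ ab ∷ x ∷ʳ proj₂ ab)) 3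
HasCard-bilateralExtensions {s} {x} {c} f r ¬r with Factor-extendʳ f
... | b , fb =
  (c , false) ∷ (c , true) ∷ (not c , b) ∷ [] , refl ,
  ((λ ()) ∷ different ∷ []) ∷ (different ∷ []) ∷ [] ∷ [] ,
  r false ∷ r true ∷ fb ∷ [] ,
  complete
  where
  different : ∀ {d} → (c , d) ≢ (not c , b)
  different = not-¬ refl ∘ cong proj₁
  c-row : ∀ d → (c , d) ∈ (c , false) ∷ (c , true) ∷ (not c , b) ∷ []
  c-row false = here refl
  c-row true  = there (here refl)
  extension-unique : ∀ {b′} → Factor s (not c ∷ x ∷ʳ b′) → b′ ≡ b
  extension-unique {b′} f′ with b′ ≟ᵇ b
  ... | yes b′≡b = b′≡b
  ... | no  b′≢b = ⊥-elim (¬r (∀Bool-from-≢ {P = λ e → Factor s (not c ∷ x ∷ʳ e)} b′≢b f′ fb))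
  complete : ∀ ab → Factor s (proj₁ ab ∷ x ∷ʳ proj₂ ab) → ab ∈ (c , false) ∷ (c , true) ∷ (not c , b) ∷ []
  complete (a , b′) f′ with a ≟ᵇ c
  ... | yes refl = c-row b′
  ... | no a≢c with ¬-not a≢c
  ...   | refl = there (there (here (cong (not c ,_) (extension-unique f′))))

module _ {s : Seq} {n k : ℕ} (L : Complexity s n k) where

  factors : List Word
  factors = proj₁ L

  length-factors : length factors ≡ k
  length-factors = proj₁ (proj₂ L)

  factors-unique : Unique factors
  factors-unique = proj₁ (proj₂ (proj₂ L))

  ∈-factors⁺ : ∀ {w} → length w ≡ n → Factor s w → w ∈ factors
  ∈-factors⁺ ∣w∣≡ fw = proj₂ (proj₂ (proj₂ (proj₂ L))) _ (∣w∣≡ , fw)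

  ∈-factors⁻ : ∀ {w} → w ∈ factors → length w ≡ n × Factor s w
  ∈-factors⁻ = All-lookup (proj₁ (proj₂ (proj₂ (proj₂ L))))

  Factor? : ∀ w → length w ≡ n → Dec (Factor s w)
  Factor? w ∣w∣≡ with any? (w ≟ʷ_) factors
  ... | yes w∈ = yes (proj₂ (∈-factors⁻ w∈))
  ... | no  w∉ = no (w∉ ∘ ∈-factors⁺ ∣w∣≡)

length-∷ʳ-≡ : ∀ {n} (w : Word) b → length w ≡ n → length (w ∷ʳ b) ≡ suc n
length-∷ʳ-≡ w b ∣w∣≡ = trans (length-∷ʳ w b) (cong suc ∣w∣≡)

RightSpecial₂? : ∀ {s n k} → Complexity s (suc n) k → ∀ w → length w ≡ n → Dec (RightSpecial₂ s w)
RightSpecial₂? L w ∣w∣≡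
  with Factor? L (w ∷ʳ false) (length-∷ʳ-≡ w false ∣w∣≡) | Factor? L (w ∷ʳ true) (length-∷ʳ-≡ w true ∣w∣≡)
... | yes f | yes t = yes λ { false → f ; true → t }
... | no ¬f | _     = no λ r → ¬f (r false)
... | _     | no ¬t = no λ r → ¬t (r true)

module RightExtension {s : Seq} {n q : ℕ} (L₊ : Complexity s (suc n) q) where

  nextLetter : Word → Bool
  nextLetter w = isNo (any? ((w ∷ʳ false) ≟ʷ_) (factors L₊))

  extend : Word → Word
  extend w = w ∷ʳ nextLetter w

  Factor-extend : ∀ {w} → length w ≡ n → Factor s w → Factor s (extend w)
  Factor-extend {w} ∣w∣≡ fw = choose (any? ((w ∷ʳ false) ≟ʷ_) (factors L₊))
    where
    choose : (d : Dec (w ∷ʳ false ∈ factors L₊)) → Factor s (w ∷ʳ isNo d)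
    choose (yes w0∈) = proj₂ (∈-factors⁻ L₊ w0∈)
    choose (no w0∉) with Factor-extendʳ fw
    ... | false , f = ⊥-elim (w0∉ (∈-factors⁺ L₊ (length-∷ʳ-≡ w false ∣w∣≡) f))
    ... | true  , f = f

  nextLetter-RightSpecial₂ : ∀ {w} → length w ≡ n → RightSpecial₂ s w → nextLetter w ≡ false
  nextLetter-RightSpecial₂ {w} ∣w∣≡ r with any? ((w ∷ʳ false) ≟ʷ_) (factors L₊)
  ... | yes _   = refl
  ... | no w0∉ = ⊥-elim (w0∉ (∈-factors⁺ L₊ (length-∷ʳ-≡ w false ∣w∣≡) (r false)))

  -- Choosing one extension per factor injects the factors of length n into those of length
  -- n + 1; every right special factor r contributes the further factor r ∷ʳ true.
  RightSpecials+complexity≤ : ∀ {p} (L : Complexity s n p) {rs} → Unique rs →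
    All (λ r → length r ≡ n × RightSpecial₂ s r) rs → length rs + p ≤ q
  RightSpecials+complexity≤ {p} L {rs} rs-unique rs-special =
    subst₂ _≤_ length-D (length-factors L₊) (Unique-⊆⇒length-≤ D-unique D⊆)
    where
    others extensions D : List Word
    others     = map (_∷ʳ true) rs
    extensions = map extend (factors L)
    D          = others ++ extensions
    length-D : length D ≡ length rs + p
    length-D = trans (length-++ others)
      (cong₂ _+_ (length-map (_∷ʳ true) rs) (trans (length-map extend (factors L)) (length-factors L)))
    nextLetter-rs : ∀ {r} → r ∈ rs → nextLetter r ≡ false
    nextLetter-rs r∈rs =
      let ∣r∣≡ , r-special = All-lookup rs-special r∈rs in nextLetter-RightSpecial₂ ∣r∣≡ r-special
    disjoint : ∀ {y} → ¬ (y ∈ others × y ∈ extensions)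
    disjoint (y∈others , y∈extensions) with ∈-map⁻ (_∷ʳ true) y∈others | ∈-map⁻ extend y∈extensions
    ... | r , r∈rs , refl | w , _ , eq with ∷ʳ-injective r w eq
    ...   | refl , true≡next with trans true≡next (nextLetter-rs r∈rs)
    ...     | ()
    D-unique : Unique D
    D-unique = ++⁺ (map⁺ (λ {x} {y} → ∷ʳ-injectiveˡ x y) rs-unique)
                   (map⁺ (λ {x} {y} → ∷ʳ-injectiveˡ x y) (factors-unique L)) disjoint
    others⊆ : others ⊆ factors L₊
    others⊆ y∈others with ∈-map⁻ (_∷ʳ true) y∈others
    ... | r , r∈rs , refl =
      let ∣r∣≡ , r-special = All-lookup rs-special r∈rs
      in ∈-factors⁺ L₊ (length-∷ʳ-≡ r true ∣r∣≡) (r-special true)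
    extensions⊆ : extensions ⊆ factors L₊
    extensions⊆ y∈extensions with ∈-map⁻ extend y∈extensions
    ... | w , w∈ , refl =
      let ∣w∣≡ , fw = ∈-factors⁻ L w∈ in ∈-factors⁺ L₊ (length-∷ʳ-≡ w _ ∣w∣≡) (Factor-extend ∣w∣≡ fw)
    D⊆ : D ⊆ factors L₊
    D⊆ y∈D = [ others⊆ , extensions⊆ ]′ (∈-++⁻ others y∈D)

  noRightSpecial⇒complexity≤ : ∀ {p} (L : Complexity s n p) →
    (∀ w → length w ≡ n → ¬ RightSpecial₂ s w) → q ≤ p
  noRightSpecial⇒complexity≤ {p} L none =
    subst₂ _≤_ (length-factors L₊) (trans (length-map extend (factors L)) (length-factors L))
      (Unique-⊆⇒length-≤ (factors-unique L₊) ⊆extensions)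
    where
    ⊆extensions : factors L₊ ⊆ map extend (factors L)
    ⊆extensions {y} y∈ with ∈-factors⁻ L₊ y∈ | initLast y
    ... | () , _    | []
    ... | ∣y∣≡ , fy | w ∷ʳ′ c =
      subst (λ d → w ∷ʳ d ∈ map extend (factors L)) (sym c≡next) (∈-map⁺ extend (∈-factors⁺ L ∣w∣≡ fw))
      where
      ∣w∣≡ : length w ≡ n
      ∣w∣≡ = suc-injective (trans (sym (length-∷ʳ w c)) ∣y∣≡)
      fw : Factor s w
      fw = Factor-∷ʳ⁻ fy
      c≡next : c ≡ nextLetter w
      c≡next with c ≟ᵇ nextLetter w
      ... | yes c≡next = c≡next
      ... | no  c≢next = ⊥-elim (none w ∣w∣≡
                           (∀Bool-from-≢ {P = λ b → Factor s (w ∷ʳ b)} c≢next fy (Factor-extend ∣w∣≡ fw)))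

HasCard-Bool : ∀ {P : Bool → Set} → (∀ b → P b) → HasCard P 2
HasCard-Bool = HasCard-full booleans booleans-unique booleans-complete

HasCard-Bool² : ∀ {P : Bool × Bool → Set} → (∀ ab → P ab) → HasCard P 4
HasCard-Bool² =
  HasCard-full (cartesianProduct booleans booleans) (cartesianProduct⁺ booleans-unique booleans-unique)
  (λ (a , b) → ∈-cartesianProduct⁺ (booleans-complete a) (booleans-complete b))

allFactors : ∀ {s n} (ws : List Word) → (∀ w → length w ≡ n → w ∈ ws) →
  Complexity s n (length ws) → ∀ w → length w ≡ n → Factor s w
allFactors ws ws-complete L w ∣w∣≡ =
  proj₂ (∈-factors⁻ L (Unique-⊆-length-≥⇒⊇ _≟ʷ_ (factors-unique L) factors⊆ws
                         (≤-reflexive (sym (length-factors L))) (ws-complete w ∣w∣≡)))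
  where
  factors⊆ws : factors L ⊆ ws
  factors⊆ws w∈ = ws-complete _ (proj₁ (∈-factors⁻ L w∈))

words₁ : List Word
words₁ = (false ∷ []) ∷ (true ∷ []) ∷ []

words₁-complete : ∀ w → length w ≡ 1 → w ∈ words₁
words₁-complete (false ∷ []) _ = here refl
words₁-complete (true ∷ [])  _ = there (here refl)

words₂ : List Word
words₂ = (false ∷ false ∷ []) ∷ (false ∷ true ∷ []) ∷ (true ∷ false ∷ []) ∷ (true ∷ true ∷ []) ∷ []

words₂-complete : ∀ w → length w ≡ 2 → w ∈ words₂
words₂-complete (false ∷ false ∷ []) _ = here refl
words₂-complete (false ∷ true ∷ [])  _ = there (here refl)
words₂-complete (true ∷ false ∷ [])  _ = there (there (here refl))
words₂-complete (true ∷ true ∷ [])   _ = there (there (there (here refl)))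

module ComplementarySymmetricRote {v : Seq} (comp : ∀ n → n ≥ 1 → Complexity v n (n + n))
                                  (closed : BarClosed v) where
  open RightExtension using (RightSpecials+complexity≤; noRightSpecial⇒complexity≤)

  factorsOfLength : ∀ k → Complexity v (suc k) (suc k + suc k)
  factorsOfLength k = comp (suc k) (s≤s z≤n)

  no-three-RightSpecials : ∀ {k r₁ r₂ r₃} → length r₁ ≡ suc k → length r₂ ≡ suc k → length r₃ ≡ suc k →
    RightSpecial₂ v r₁ → RightSpecial₂ v r₂ → RightSpecial₂ v r₃ → r₁ ≢ r₂ → r₁ ≢ r₃ → r₂ ≢ r₃ → ⊥
  no-three-RightSpecials {k} ∣r₁∣≡ ∣r₂∣≡ ∣r₃∣≡ s₁ s₂ s₃ r₁≢r₂ r₁≢r₃ r₂≢r₃ =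
    1+n≰n (subst (3 + (suc k + suc k) ≤_) (cong suc (+-suc (suc k) (suc k)))
      (RightSpecials+complexity≤ (factorsOfLength (suc k)) (factorsOfLength k)
        ((r₁≢r₂ ∷ r₁≢r₃ ∷ []) ∷ (r₂≢r₃ ∷ []) ∷ [] ∷ [])
        ((∣r₁∣≡ , s₁) ∷ (∣r₂∣≡ , s₂) ∷ (∣r₃∣≡ , s₃) ∷ [])))

  RightSpecial-exists : ∀ k → ¬ (∀ w → length w ≡ suc k → ¬ RightSpecial₂ v w)
  RightSpecial-exists k none =
    1+n≰n (≤-trans (noRightSpecial⇒complexity≤ (factorsOfLength (suc k)) (factorsOfLength k) none)
                   (+-monoʳ-≤ (suc k) (n≤1+n (suc k))))

  module _ {a u} (x-special : RightSpecial₂ v (a ∷ u)) where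

    RightSpecial₂⇒≡⊎≡bar : ∀ {w} → length w ≡ suc (length u) → RightSpecial₂ v w → w ≡ a ∷ u ⊎ w ≡ bar (a ∷ u)
    RightSpecial₂⇒≡⊎≡bar {w} ∣w∣≡ w-special with w ≟ʷ (a ∷ u) | w ≟ʷ bar (a ∷ u)
    ... | yes w≡x | _        = inj₁ w≡x
    ... | no _    | yes w≡x̄ = inj₂ w≡x̄
    ... | no w≢x  | no w≢x̄  = ⊥-elim (no-three-RightSpecials ∣w∣≡ refl (cong suc (length-bar u))
            w-special x-special (RightSpecial₂-bar closed (a ∷ u) x-special) w≢x w≢x̄ (∷-≢-bar a u))

    not-both : RightSpecial₂ v (false ∷ a ∷ u) → ¬ RightSpecial₂ v (true ∷ a ∷ u)
    not-both r₀ r₁ = no-three-RightSpecials refl refl (cong (suc ∘ suc) (length-bar u))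
      r₀ r₁ (RightSpecial₂-bar closed (true ∷ a ∷ u) r₁) (λ ()) (∷-≢-bar a u ∘ proj₂ ∘ ∷-injective) (λ ())

    not-neither : ¬ RightSpecial₂ v (false ∷ a ∷ u) → ¬ RightSpecial₂ v (true ∷ a ∷ u) → ⊥
    not-neither ¬r₀ ¬r₁ = RightSpecial-exists (suc (length u)) none
      where
      ¬r : ∀ c → ¬ RightSpecial₂ v (c ∷ a ∷ u)
      ¬r false = ¬r₀
      ¬r true  = ¬r₁
      none : ∀ w → length w ≡ suc (suc (length u)) → ¬ RightSpecial₂ v w
      none (c ∷ w) ∣w∣≡ r with RightSpecial₂⇒≡⊎≡bar (suc-injective ∣w∣≡) (RightSpecial₂-∷⁻ r)
      ... | inj₁ refl = ¬r c r
      ... | inj₂ refl = ¬r (not c)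
            (subst (λ y → RightSpecial₂ v (not c ∷ y)) (bar-involutive (a ∷ u))
                   (RightSpecial₂-bar closed (c ∷ bar (a ∷ u)) r))

    left-extension-unique : ∃ λ c → RightSpecial₂ v (c ∷ a ∷ u) × ¬ RightSpecial₂ v (not c ∷ a ∷ u)
    left-extension-unique with RightSpecial₂? L (false ∷ a ∷ u) refl | RightSpecial₂? L (true ∷ a ∷ u) refl
      where L = factorsOfLength (suc (suc (length u)))
    ... | yes r₀ | _      = false , r₀ , not-both r₀
    ... | no ¬r₀ | yes r₁ = true , r₁ , ¬r₀
    ... | no ¬r₀ | no ¬r₁ = ⊥-elim (not-neither ¬r₀ ¬r₁)

  Bispecial⇒Ordinary : ∀ {a u} → Bispecial v (a ∷ u) → Ordinary v (a ∷ u)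
  Bispecial⇒Ordinary (ls , rs) with left-extension-unique (RightSpecial⇒RightSpecial₂ (_ ∷ _) rs)
  ... | c , r , ¬r = 3 , 2 , 2 ,
    HasCard-bilateralExtensions (LeftSpecial⇒LeftSpecial₂ ls (not c)) r ¬r ,
    HasCard-Bool (LeftSpecial⇒LeftSpecial₂ ls) , HasCard-Bool (RightSpecial⇒RightSpecial₂ (_ ∷ _) rs) , refl

  letters : ∀ a → Factor v [ a ]
  letters a = allFactors words₁ words₁-complete (comp 1 (s≤s z≤n)) [ a ] refl

  twoLetterWords : ∀ a b → Factor v (a ∷ b ∷ [])
  twoLetterWords a b = allFactors words₂ words₂-complete (comp 2 (s≤s z≤n)) (a ∷ b ∷ []) refl

  []-Bispecial : Bispecial v []
  []-Bispecial = LeftSpecial₂⇒LeftSpecial letters , RightSpecial₂⇒RightSpecial [] letters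

  []-Strong : Strong v []
  []-Strong = + 1 ,
    (4 , 2 , 2 , HasCard-Bool² (λ (a , b) → twoLetterWords a b) ,
     HasCard-Bool letters , HasCard-Bool letters , refl) ,
    +<+ (s≤s z≤n)

corollary2p8 : (v : Seq) → CSRote v →
    ((ℓ : ℕ) (w : Word) → length w ≡ ℓ → Bispecial (Sseq v) w →
        Σ Word λ x → (length x ≡ suc ℓ) × Bispecial v x × Bispecial v (bar x)
          × (w ≡ Sw x) × (w ≡ Sw (bar x)))
    × ((ℓ : ℕ) (x : Word) → length x ≡ suc ℓ → Bispecial v x →
        (length (Sw x) ≡ ℓ) × Bispecial (Sseq v) (Sw x))
    × ((x : Word) → x ≢ [] → Bispecial v x → Ordinary v x)
    × (Bispecial v [] × Strong v [])
corollary2p8 v (comp , closed) =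
  Bispecial-Sseq⇒preimages closed ,
  (λ { ℓ (a ∷ u) ∣x∣≡ bs → trans (length-Sw a u) (suc-injective ∣x∣≡) , Bispecial-Sw⁺ bs }) ,
  (λ { [] []≢[] _ → ⊥-elim ([]≢[] refl) ; (a ∷ u) _ bs → Bispecial⇒Ordinary bs }) ,
  []-Bispecial , []-Strong
  where open ComplementarySymmetricRote comp closed
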